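{- Let $A$ be a finite alphabet with $m\ge2$ letters and $k\ge1$. For every $n\ge0$, the number of $k$-Abelian equivalence classes of $A^{n+1}$ is at least the number of $k$-Abelian equivalence classes of $A^n$.
   Context: Two words $u,v$ are $k$-Abelian equivalent if $|u|_x=|v|_x$ for every non-empty word $x$ with $|x|\le k$, where $|u|_x$ counts occurrences of $x$ as a factor of $u$. -}

module Defs where

open import Data.Bool using (Bool; true; false; if_then_else_)
open import Data.Nat using (ℕ; zero; suc; _+_; _≤_; _<_; s≤s; z≤n)
open import Data.Nat.Properties using (allUpTo?)
import Data.Nat.Properties as ℕP
open import Data.Fin using (Fin)
open import Data.Fin.Properties using (all?) renaming (_≟_ to _≟F_)
open import Data.List using (List; []; _∷_; length; concatMap; map; allFin; deduplicate)
open import Data.Vec using (Vec; []; _∷_; toList; fromList)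
open import Data.Vec.Properties using (toList∘fromList; length-toList)
open import Relation.Nullary using (Dec; yes; no; does)
open import Relation.Nullary.Decidable using (map′)
open import Relation.Binary.PropositionalEquality using (_≡_; refl; subst; sym)

Word : ℕ → Set
Word m = List (Fin m)

isPrefix : ∀ {m} → Word m → Word m → Bool
isPrefix []      _       = true
isPrefix (_ ∷ _) []      = false
isPrefix (a ∷ x) (b ∷ u) = if does (a ≟F b) then isPrefix x u else false

-- |u|_x : number of positions of u at which x occurs as a factor
-- (counted over the non-empty suffixes of u; x is always non-empty below).
occ : ∀ {m} → Word m → Word m → ℕ
occ x []      = 0
occ x (a ∷ u) = (if isPrefix x (a ∷ u) then 1 else 0) + occ x u

_≡[_]ab_ : ∀ {m} → Word m → ℕ → Word m → Set
u ≡[ k ]ab v = ∀ x → 1 ≤ length x → length x ≤ k → occ x u ≡ occ x v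

allVec? : ∀ {m l} {P : Vec (Fin m) l → Set} → (∀ v → Dec (P v)) → Dec (∀ v → P v)
allVec? {l = zero} P? = map′ (λ { p [] → p }) (λ f → f []) (P? [])
allVec? {l = suc l} P? =
  map′ (λ { f (a ∷ v) → f a v }) (λ f a v → f (a ∷ v))
       (all? (λ a → allVec? (λ v → P? (a ∷ v))))

kab? : ∀ {m} k (u v : Word m) → Dec (u ≡[ k ]ab v)
kab? {m} k u v = map′ to from (allUpTo? P? k)
  where
  P : ℕ → Set
  P l = ∀ (x : Vec (Fin m) (suc l)) → occ (toList x) u ≡ occ (toList x) v
  P? : ∀ l → Dec (P l)
  P? l = allVec? (λ x → occ (toList x) u ℕP.≟ occ (toList x) v)
  to : (∀ {l} → l < k → P l) → u ≡[ k ]ab v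
  to h (a ∷ xs) _ len≤k =
    subst (λ y → occ y u ≡ occ y v) (toList∘fromList (a ∷ xs)) (h len≤k (fromList (a ∷ xs)))
  from : u ≡[ k ]ab v → ∀ {l} → l < k → P l
  from f {l} l<k x =
    f (toList x) (subst (1 ≤_) (sym (length-toList x)) (s≤s z≤n))
                 (subst (_≤ k) (sym (length-toList x)) l<k)

allWords : ∀ m → ℕ → List (Word m)
allWords m zero    = [] ∷ []
allWords m (suc n) = concatMap (λ a → map (a ∷_) (allWords m n)) (allFin m)

-- Number of k-Abelian equivalence classes of A^n: the length of the list
-- of class representatives obtained by deleting from the enumeration of A^n
-- every word k-Abelian equivalent to an earlier one.
numClasses : (m k n : ℕ) → ℕ
numClasses m k n = length (deduplicate (kab? k) (allWords m n))

-- Send a pair (class of x in Aⁿ, letter a) to the pair (class of ax in Aⁿ⁺¹,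
-- k-th letter of ax). This is injective: the counts of factors of length ≤ k
-- determine the prefix of length k − 1 of a word of given length, so the extra
-- letter recovers the prefix of length k of ax, hence a; and deleting a common
-- first letter from two words that share their prefix of length k preserves
-- k-Abelian equivalence. Counting both sides,
-- |A| · #classes(Aⁿ) ≤ |A| · #classes(Aⁿ⁺¹).
module Submission where

open import Defs
open import Data.Nat using (ℕ; zero; suc; _+_; _*_; _≤_; s≤s; z≤n; NonZero)
import Data.Nat.Properties as ℕₚ
open import Data.Bool using (Bool; true; false; if_then_else_)
open import Data.Fin using (Fin; zero; suc; punchIn)
open import Data.Fin.Properties using (_≟_; punchInᵢ≢i; injective⇒≤; *↔×)
open import Data.Maybe using (fromMaybe)
open import Data.List using (List; []; _∷_; length; take; drop; head; lookup; map; allFin; deduplicate)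
open import Data.List.Properties using (∷-injective; length-take)
open import Data.List.Membership.Propositional using (_∈_)
open import Data.List.Membership.Propositional.Properties
  using (∈-lookup; ∈-allFin; ∈-map⁺; ∈-map⁻; ∈-concatMap⁺; ∈-concatMap⁻)
open import Data.List.Relation.Unary.Any as Any using (Any; here)
open import Data.List.Relation.Unary.Any.Properties using (deduplicate⁺; deduplicate⁻; lookup-index)
import Data.List.Relation.Unary.All as All
open import Data.List.Relation.Unary.AllPairs using (_∷_)
open import Data.List.Relation.Unary.Unique.Setoid using (Unique)
open import Data.List.Relation.Unary.Unique.DecSetoid.Properties using (deduplicate-!)
open import Data.Product using (_×_; _,_)
open import Data.Product.Properties using (,-injective)
open import Data.Vec.Functional using (removeAt)
open import Algebra.Properties.CommutativeMonoid.Sum ℕₚ.+-0-commutativeMonoid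
  using (sum; sum-cong-≗; sum-remove; ∑-distrib-+; sum-replicate-zero)
open import Function using (_↣_; mk↣; Injection)
open import Function.Definitions using (Injective)
open import Function.Construct.Composition using (_↣-∘_)
open import Function.Construct.Symmetry using (↔-sym)
open import Function.Properties.Inverse using (↔⇒↣)
open import Relation.Binary.Bundles using (Setoid; DecSetoid)
open import Relation.Nullary using (yes; no; does; contradiction)
open import Relation.Nullary.Decidable using (dec-true; dec-false)
open import Relation.Binary.PropositionalEquality
open ≡-Reasoning

×-↣⇒≤ : ∀ {p q r} .{{_ : NonZero r}} → (Fin p × Fin r) ↣ (Fin q × Fin r) → p ≤ q
×-↣⇒≤ {p} {q} {r} f = ℕₚ.*-cancelʳ-≤ p q r (injective⇒≤ (Injection.injective g))
  where
  g : Fin (p * r) ↣ Fin (q * r)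
  g = ↔⇒↣ (↔-sym *↔×) ↣-∘ (f ↣-∘ ↔⇒↣ *↔×)

module _ {a ℓ} (S : Setoid a ℓ) where
  open Setoid S using (_≈_) renaming (sym to ≈-sym)

  Unique⇒lookup-injective : ∀ {xs} → Unique S xs → ∀ {i j} → lookup xs i ≈ lookup xs j → i ≡ j
  Unique⇒lookup-injective (_ ∷ _)  {zero}  {zero}  _  = refl
  Unique⇒lookup-injective (x≉ ∷ _) {zero}  {suc j} x≈ = contradiction x≈ (All.lookup x≉ (∈-lookup j))
  Unique⇒lookup-injective (x≉ ∷ _) {suc i} {zero}  x≈ = contradiction (≈-sym x≈) (All.lookup x≉ (∈-lookup i))
  Unique⇒lookup-injective (_ ∷ u)  {suc i} {suc j} x≈ = cong suc (Unique⇒lookup-injective u x≈)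

sum-indicator : ∀ {m} (c : Fin m) n → sum (λ b → if does (b ≟ c) then n else 0) ≡ n
sum-indicator {suc m} c n = begin
  sum t                     ≡⟨ sum-remove {i = c} t ⟩
  t c + sum (removeAt t c)  ≡⟨ cong₂ _+_ t-at-c (trans (sum-cong-≗ t-off-c) (sum-replicate-zero m)) ⟩
  n + 0                     ≡⟨ ℕₚ.+-identityʳ n ⟩
  n                         ∎
  where
  t : Fin (suc m) → ℕ
  t b = if does (b ≟ c) then n else 0
  t-at-c : t c ≡ n
  t-at-c rewrite dec-true (c ≟ c) refl = refl
  t-off-c : ∀ j → t (punchIn c j) ≡ 0
  t-off-c j rewrite dec-false (punchIn c j ≟ c) (punchInᵢ≢i c j) = refl

𝟙 : Bool → ℕ
𝟙 b = if b then 1 else 0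

𝟙-injective : ∀ {b c} → 𝟙 b ≡ 𝟙 c → b ≡ c
𝟙-injective {false} {false} _ = refl
𝟙-injective {true}  {true}  _ = refl

𝟙-isPrefix-∷ : ∀ {m} (b c : Fin m) y w →
               𝟙 (isPrefix (b ∷ y) (c ∷ w)) ≡ (if does (b ≟ c) then 𝟙 (isPrefix y w) else 0)
𝟙-isPrefix-∷ b c y w with does (b ≟ c)
... | true  = refl
... | false = refl

occ-∷-split : ∀ {m} (d : Fin m) y w →
              occ (d ∷ y) w ≡ 𝟙 (isPrefix (d ∷ y) w) + sum (λ b → occ (b ∷ d ∷ y) w)
occ-∷-split {m} d y []      = sym (sum-replicate-zero m)
occ-∷-split {m} d y (c ∷ w) = cong (𝟙 (isPrefix (d ∷ y) (c ∷ w)) +_) (begin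
  occ (d ∷ y) w
    ≡⟨ occ-∷-split d y w ⟩
  𝟙 p + sum (λ b → occ (b ∷ d ∷ y) w)
    ≡⟨ cong (_+ _) (sym (sum-indicator c (𝟙 p))) ⟩
  sum (λ b → if does (b ≟ c) then 𝟙 p else 0) + sum (λ b → occ (b ∷ d ∷ y) w)
    ≡⟨ sym (∑-distrib-+ {m} _ _) ⟩
  sum (λ b → (if does (b ≟ c) then 𝟙 p else 0) + occ (b ∷ d ∷ y) w)
    ≡⟨ sum-cong-≗ {m} (λ b → cong (_+ occ (b ∷ d ∷ y) w) (sym (𝟙-isPrefix-∷ b c (d ∷ y) w))) ⟩
  sum (λ b → occ (b ∷ d ∷ y) (c ∷ w))
    ∎)
  where
  p = isPrefix (d ∷ y) w

isPrefix-take : ∀ {m} l (u : Word m) → isPrefix (take l u) u ≡ true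
isPrefix-take zero    u       = refl
isPrefix-take (suc l) []      = refl
isPrefix-take (suc l) (a ∷ u) rewrite dec-true (a ≟ a) refl = isPrefix-take l u

isPrefix≡isPrefix-take : ∀ {m} (y w : Word m) l → length y ≤ l → isPrefix y w ≡ isPrefix y (take l w)
isPrefix≡isPrefix-take []      w       l       _         = refl
isPrefix≡isPrefix-take (d ∷ y) []      (suc l) _         = refl
isPrefix≡isPrefix-take (d ∷ y) (c ∷ w) (suc l) (s≤s |y|≤l) with does (d ≟ c)
... | true  = isPrefix≡isPrefix-take y w l |y|≤l
... | false = refl

isPrefix-take⇒take-≡ : ∀ {m} l (u v : Word m) → isPrefix (take l u) v ≡ true →
                       length u ≡ length v → take l u ≡ take l v
isPrefix-take⇒take-≡ zero    u       v       _ _ = refl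
isPrefix-take⇒take-≡ (suc l) []      []      _ _ = refl
isPrefix-take⇒take-≡ (suc l) (a ∷ u) (b ∷ v) pre |u|≡|v| with a ≟ b
... | yes refl = cong (a ∷_) (isPrefix-take⇒take-≡ l u v pre (ℕₚ.suc-injective |u|≡|v|))
isPrefix-take⇒take-≡ (suc l) (a ∷ u) (b ∷ v) () _ | no _

letterAt : ∀ {m} → Fin m → ℕ → Word m → Fin m
letterAt d i u = fromMaybe d (head (drop i u))

take-suc-≡ : ∀ {m} (d : Fin m) i {u v : Word m} → length u ≡ length v →
             take i u ≡ take i v → letterAt d i u ≡ letterAt d i v → take (suc i) u ≡ take (suc i) v
take-suc-≡ d i       {[]}    {[]}    _        _  _  = refl
take-suc-≡ d i       {[]}    {_ ∷ _} ()
take-suc-≡ d i       {_ ∷ _} {[]}    ()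
take-suc-≡ d zero    {_ ∷ _} {_ ∷ _} _        _  eq = cong (_∷ []) eq
take-suc-≡ d (suc i) {_ ∷ _} {_ ∷ _} |u|≡|v| eq₁ eq₂ with c≡c′ , eq₁′ ← ∷-injective eq₁ =
  cong₂ _∷_ c≡c′ (take-suc-≡ d i (ℕₚ.suc-injective |u|≡|v|) eq₁′ eq₂)

≡ab-sym : ∀ {m k} {u v : Word m} → u ≡[ k ]ab v → v ≡[ k ]ab u
≡ab-sym e x l₁ l₂ = sym (e x l₁ l₂)

≡ab-trans : ∀ {m k} {u v w : Word m} → u ≡[ k ]ab v → v ≡[ k ]ab w → u ≡[ k ]ab w
≡ab-trans e f x l₁ l₂ = trans (e x l₁ l₂) (f x l₁ l₂)

≡ab-decSetoid : ℕ → ℕ → DecSetoid _ _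
≡ab-decSetoid m k = record
  { Carrier          = Word m
  ; _≈_              = _≡[ k ]ab_
  ; isDecEquivalence = record
    { isEquivalence = record
      { refl  = λ _ _ _ → refl
      ; sym   = λ {u} {v} → ≡ab-sym {u = u} {v}
      ; trans = λ {u} {v} {w} → ≡ab-trans {u = u} {v} {w}
      }
    ; _≟_ = kab? k
    }
  }

≡ab-setoid : ℕ → ℕ → Setoid _ _
≡ab-setoid m k = DecSetoid.setoid (≡ab-decSetoid m k)

-- By occ-∷-split, the indicator of y being a prefix is a difference of factor
-- counts of lengths ≤ k, which k-Abelian equivalence fixes.
≡ab-isPrefix : ∀ {m k} {u v : Word m} → u ≡[ suc k ]ab v → ∀ y → length y ≤ k →
               isPrefix y u ≡ isPrefix y v
≡ab-isPrefix e [] _ = refl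
≡ab-isPrefix {u = u} {v} e (d ∷ y) |dy|≤k = 𝟙-injective (ℕₚ.+-cancelʳ-≡ _ _ _ (begin
  𝟙 (isPrefix (d ∷ y) u) + sum (λ b → occ (b ∷ d ∷ y) u)  ≡⟨ sym (occ-∷-split d y u) ⟩
  occ (d ∷ y) u                                           ≡⟨ e (d ∷ y) (s≤s z≤n) (ℕₚ.m≤n⇒m≤1+n |dy|≤k) ⟩
  occ (d ∷ y) v                                           ≡⟨ occ-∷-split d y v ⟩
  𝟙 (isPrefix (d ∷ y) v) + sum (λ b → occ (b ∷ d ∷ y) v)  ≡⟨ cong (_ +_) (sum-cong-≗ λ b → sym (e (b ∷ d ∷ y) (s≤s z≤n) (s≤s |dy|≤k))) ⟩
  𝟙 (isPrefix (d ∷ y) v) + sum (λ b → occ (b ∷ d ∷ y) u)  ∎))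

≡ab-take : ∀ {m k} {u v : Word m} → u ≡[ suc k ]ab v → length u ≡ length v → take k u ≡ take k v
≡ab-take {k = k} {u} {v} e |u|≡|v| = isPrefix-take⇒take-≡ k u v
  (trans (sym (≡ab-isPrefix e (take k u) |take-k-u|≤k)) (isPrefix-take k u)) |u|≡|v|
  where
  |take-k-u|≤k : length (take k u) ≤ k
  |take-k-u|≤k = ℕₚ.≤-trans (ℕₚ.≤-reflexive (length-take k u)) (ℕₚ.m⊓n≤m k (length u))

≡ab-∷⁻ : ∀ {m k} (a : Fin m) {x x′ : Word m} → take k x ≡ take k x′ →
         (a ∷ x) ≡[ suc k ]ab (a ∷ x′) → x ≡[ suc k ]ab x′
≡ab-∷⁻ {k = k} a {x} {x′} eq e y l₁ l₂ = ℕₚ.+-cancelˡ-≡ (𝟙 (isPrefix y (a ∷ x))) _ _ (begin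
  𝟙 (isPrefix y (a ∷ x)) + occ y x    ≡⟨ e y l₁ l₂ ⟩
  𝟙 (isPrefix y (a ∷ x′)) + occ y x′  ≡⟨ cong (λ b → 𝟙 b + occ y x′) (sym same-prefix) ⟩
  𝟙 (isPrefix y (a ∷ x)) + occ y x′   ∎)
  where
  same-prefix : isPrefix y (a ∷ x) ≡ isPrefix y (a ∷ x′)
  same-prefix = begin
    isPrefix y (a ∷ x)          ≡⟨ isPrefix≡isPrefix-take y (a ∷ x) (suc k) l₂ ⟩
    isPrefix y (a ∷ take k x)   ≡⟨ cong (λ z → isPrefix y (a ∷ z)) eq ⟩
    isPrefix y (a ∷ take k x′)  ≡⟨ isPrefix≡isPrefix-take y (a ∷ x′) (suc k) l₂ ⟨
    isPrefix y (a ∷ x′)         ∎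

≡ab-∷-injective : ∀ {m k} (d : Fin m) {a a′ : Fin m} {x x′ : Word m} → length x ≡ length x′ →
                  (a ∷ x) ≡[ suc k ]ab (a′ ∷ x′) → letterAt d k (a ∷ x) ≡ letterAt d k (a′ ∷ x′) →
                  a ≡ a′ × x ≡[ suc k ]ab x′
≡ab-∷-injective {k = k} d {a} |x|≡|x′| e eq
  with refl , eq′ ← ∷-injective (take-suc-≡ d k (cong suc |x|≡|x′|) (≡ab-take e (cong suc |x|≡|x′|)) eq)
  = refl , ≡ab-∷⁻ a eq′ e

∈-allWords⁻ : ∀ {m} n {w : Word m} → w ∈ allWords m n → length w ≡ n
∈-allWords⁻ zero (here refl) = refl
∈-allWords⁻ {m} (suc n) w∈
  with a , w∈a∷ ← Any.satisfied (∈-concatMap⁻ (λ a → map (a ∷_) (allWords m n)) {xs = allFin m} w∈)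
  with x , x∈ , refl ← ∈-map⁻ (a ∷_) w∈a∷
  = cong suc (∈-allWords⁻ n x∈)

∈-allWords⁺ : ∀ {m} (w : Word m) → w ∈ allWords m (length w)
∈-allWords⁺     []      = here refl
∈-allWords⁺ {m} (a ∷ w) = ∈-concatMap⁺ (λ a → map (a ∷_) (allWords m (length w)))
  (Any.map (λ { refl → ∈-map⁺ (a ∷_) (∈-allWords⁺ w) }) (∈-allFin a))

classes : (m k n : ℕ) → List (Word m)
classes m k n = deduplicate (kab? k) (allWords m n)

classes-length : ∀ {m k} n {w : Word m} → w ∈ classes m k n → length w ≡ n
classes-length {k = k} n w∈ = ∈-allWords⁻ n (deduplicate⁻ (kab? k) w∈)

classes-unique : ∀ m k n → Unique (≡ab-setoid m k) (classes m k n)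
classes-unique m k n = deduplicate-! (≡ab-decSetoid m k) (allWords m n)

classes-complete : ∀ {m k n} (w : Word m) → length w ≡ n → Any (w ≡[ k ]ab_) (classes m k n)
classes-complete {k = k} w refl = deduplicate⁺ (kab? k)
  (λ {y} {z} z≈y w≈y → ≡ab-trans {u = w} {y} {z} w≈y (≡ab-sym {u = z} {y} z≈y))
  (Any.map (λ { refl _ _ _ → refl }) (∈-allWords⁺ w))

numClasses-mono : ∀ m k n → numClasses (suc m) (suc k) n ≤ numClasses (suc m) (suc k) (suc n)
numClasses-mono m k n = ×-↣⇒≤ (mk↣ extend-injective)
  where
  X = classes (suc m) (suc k) n
  Y = classes (suc m) (suc k) (suc n)
  rep : Fin (length X) → Word (suc m)
  rep = lookup X
  |rep| : ∀ i → length (rep i) ≡ n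
  |rep| i = classes-length n (∈-lookup i)
  class : ∀ i a → Any ((a ∷ rep i) ≡[ suc k ]ab_) Y
  class i a = classes-complete (a ∷ rep i) (cong suc (|rep| i))
  extend : Fin (length X) × Fin (suc m) → Fin (length Y) × Fin (suc m)
  extend (i , a) = Any.index (class i a) , letterAt zero k (a ∷ rep i)
  same-class : ∀ {i a i′ a′} → Any.index (class i a) ≡ Any.index (class i′ a′) →
               (a ∷ rep i) ≡[ suc k ]ab (a′ ∷ rep i′)
  same-class {i} {a} {i′} {a′} eq = ≡ab-trans {u = a ∷ rep i} {y} {a′ ∷ rep i′}
    (lookup-index (class i a)) (≡ab-sym {u = a′ ∷ rep i′} {y} a′x′≈y)
    where
    y = lookup Y (Any.index (class i a))
    a′x′≈y : (a′ ∷ rep i′) ≡[ suc k ]ab y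
    a′x′≈y rewrite eq = lookup-index (class i′ a′)
  extend-injective : Injective _≡_ _≡_ extend
  extend-injective {i , a} {i′ , a′} eq
    with same-index , same-letter ← ,-injective eq
    with refl , x≈x′ ← ≡ab-∷-injective zero (trans (|rep| i) (sym (|rep| i′))) (same-class same-index) same-letter
    = cong (_, a) (Unique⇒lookup-injective (≡ab-setoid (suc m) (suc k)) (classes-unique (suc m) (suc k) n) x≈x′)

lemma11 : (m k : ℕ) → 2 ≤ m → 1 ≤ k → (n : ℕ) →
              numClasses m k n ≤ numClasses m k (suc n)
lemma11 zero    _       ()
lemma11 (suc m) zero    _  ()
lemma11 (suc m) (suc k) _  _  = numClasses-mono m k
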